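{- If $G$ is a generalized geodetic graph with $\mathrm{sgc}(G) >\frac{\mathrm{sg}(G)}{2}$ and $H$ is a graph that admits a convex $2$-partition, then $\mathrm{sg}(G \,\square\, H) > \mathrm{sg}(G)$.
   Context: Graphs are finite and simple; strong geodetic notions are considered for connected graphs. $G\,\square\,H$ is the Cartesian product: vertex set $V(G)\times V(H)$, with $(g,h)\sim(g',h')$ iff either $g=g'$ and $hh'\in E(H)$, or $h=h'$ and $gg'\in E(G)$. For $S\subseteq V(G)$, one fixes for each unordered pair $\{x,y\}$ of distinct vertices of $S$ a single shortest $x,y$-path $\widetilde g(x,y)$; $S$ is a strong geodetic set if for some such choice the union of the vertex sets of the chosen paths equals $V(G)$. $\mathrm{sg}(G)$ is the minimum size of a strong geodetic set; a minimum one is an sg-set. For a strong geodetic set $S$, a set $X\subseteq S$ is a strong geodetic core for $S$ if there exists a choice of fixed shortest paths $\widetilde g(x,y)$ for pairs of $S$ such that $\bigcup_{(u,v)\in X\times S} V(\widetilde g(u,v)) = V(G)$; $\mathrm{sgc}(S)$ is the minimum size of a strong geodetic core for $S$, and $\mathrm{sgc}(G)=\min\{\mathrm{sgc}(S): S \text{ an sg-set}\}$. The interval $I_G(u,v)$ is the set of vertices on some shortest $u,v$-path; the geodetic number $\mathrm{g}(G)$ is the minimum size of $S$ with $\bigcup_{\{u,v\}\subseteq S} I_G(u,v)=V(G)$; $G$ is generalized geodetic if $\mathrm{g}(G)=\mathrm{sg}(G)$. A subgraph $K$ of $H$ is convex if for all $u,v\in V(K)$ every shortest $u,v$-path in $H$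 lies in $K$. $H$ admits a convex $2$-partition if $V(H)$ can be partitioned into two nonempty sets each inducing a convex subgraph. -}

module Defs where

open import Data.Nat as ℕ using (ℕ; zero; suc)
open import Data.Bool using (Bool; true; false; T; _∧_; _∨_)
open import Data.Fin as Fin using (Fin; remQuot; _≟_)
open import Data.Fin.Subset using (Subset; ∁; _∈_; _∉_; _⊆_; ∣_∣)
open import Data.Product using (Σ; ∃; ∃-syntax; _×_; _,_; proj₁; proj₂)
open import Data.Sum using (_⊎_)
open import Relation.Nullary using (¬_)
open import Relation.Nullary.Decidable using (⌊_⌋)
open import Relation.Binary.PropositionalEquality using (_≡_; _≢_; refl)
open import Relation.Nullary using (yes; no)
open import Data.Empty using (⊥-elim)

≟-sym : ∀ {m} (a b : Fin m) → ⌊ a ≟ b ⌋ ≡ ⌊ b ≟ a ⌋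
≟-sym a b with a ≟ b | b ≟ a
... | yes _ | yes _ = refl
... | no _ | no _ = refl
... | yes refl | no q = ⊥-elim (q refl)
... | no p | yes refl = ⊥-elim (p refl)

≟-refl : ∀ {m} (a : Fin m) → ⌊ a ≟ a ⌋ ≡ true
≟-refl a with a ≟ a
... | yes _ = refl
... | no p = ⊥-elim (p refl)

record Graph : Set where
  field
    n     : ℕ
    adj   : Fin n → Fin n → Bool
    sym   : ∀ x y → adj x y ≡ adj y x
    irref : ∀ x → adj x x ≡ false

open Graph public

Vertex : Graph → Set
Vertex G = Fin (n G)

Adj : (G : Graph) → Vertex G → Vertex G → Set
Adj G x y = T (adj G x y)

data Walk (G : Graph) : Vertex G → Vertex G → ℕ → Set where
  []  : ∀ {x} → Walk G x x 0
  _∷_ : ∀ {x y z k} → Adj G x y → Walk G y z k → Walk G x z (suc k)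

data OnWalk (G : Graph) (v : Vertex G) : ∀ {x y k} → Walk G x y k → Set where
  here-nil  : OnWalk G v {v} {v} {0} []
  here-cons : ∀ {y z k} (e : Adj G v y) (w : Walk G y z k) → OnWalk G v (e ∷ w)
  there     : ∀ {x y z k} (e : Adj G x y) {w : Walk G y z k} → OnWalk G v w → OnWalk G v (e ∷ w)

Connected : Graph → Set
Connected G = ∀ (x y : Vertex G) → ∃[ k ] Walk G x y k

record Geodesic (G : Graph) (x y : Vertex G) : Set where
  field
    len      : ℕ
    walk     : Walk G x y len
    shortest : ∀ {k} → Walk G x y k → len ℕ.≤ k

OnGeo : (G : Graph) {x y : Vertex G} → Vertex G → Geodesic G x y → Set
OnGeo G v P = OnWalk G v (Geodesic.walk P)

InInterval : (G : Graph) → Vertex G → Vertex G → Vertex G → Set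
InInterval G u w v = Σ (Geodesic G u w) λ P → OnGeo G v P

IsGeodeticSet : (G : Graph) → Subset (n G) → Set
IsGeodeticSet G S = ∀ v → ∃[ u ] ∃[ w ] (u ∈ S × w ∈ S × InInterval G u w v)

IsGeodeticNumber : Graph → ℕ → Set
IsGeodeticNumber G k =
  (∃[ S ] (IsGeodeticSet G S × ∣ S ∣ ≡ k)) ×
  (∀ S → IsGeodeticSet G S → k ℕ.≤ ∣ S ∣)

-- A choice of one fixed shortest path for every unordered pair {x,y} of
-- distinct vertices of S; the pair is represented by x < y.
PathChoice : (G : Graph) → Subset (n G) → Set
PathChoice G S = ∀ (x y : Vertex G) → x ∈ S → y ∈ S → x Fin.< y → Geodesic G x y

OnChosen : (G : Graph) (S : Subset (n G)) → PathChoice G S →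
           (u w v : Vertex G) → u ∈ S → w ∈ S → Set
OnChosen G S P u w v u∈ w∈ =
  (Σ (u Fin.< w) λ lt → OnGeo G v (P u w u∈ w∈ lt)) ⊎
  (Σ (w Fin.< u) λ lt → OnGeo G v (P w u w∈ u∈ lt))

IsStrongGeodeticSet : (G : Graph) → Subset (n G) → Set
IsStrongGeodeticSet G S =
  Σ (PathChoice G S) λ P →
    ∀ v → ∃[ u ] ∃[ w ] Σ (u ∈ S) λ u∈ → Σ (w ∈ S) λ w∈ → OnChosen G S P u w v u∈ w∈

IsSgNumber : Graph → ℕ → Set
IsSgNumber G k =
  (∃[ S ] (IsStrongGeodeticSet G S × ∣ S ∣ ≡ k)) ×
  (∀ S → IsStrongGeodeticSet G S → k ℕ.≤ ∣ S ∣)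

IsSgSet : (G : Graph) → Subset (n G) → Set
IsSgSet G S = IsStrongGeodeticSet G S × (∀ S' → IsStrongGeodeticSet G S' → ∣ S ∣ ℕ.≤ ∣ S' ∣)

IsCore : (G : Graph) (S X : Subset (n G)) → Set
IsCore G S X =
  Σ (X ⊆ S) λ sub →
  Σ (PathChoice G S) λ P →
    ∀ v → ∃[ u ] ∃[ w ] Σ (u ∈ X) λ u∈X → Σ (w ∈ S) λ w∈ →
      OnChosen G S P u w v (sub u∈X) w∈

IsSgcOfSet : (G : Graph) → Subset (n G) → ℕ → Set
IsSgcOfSet G S c =
  (∃[ X ] (IsCore G S X × ∣ X ∣ ≡ c)) ×
  (∀ X → IsCore G S X → c ℕ.≤ ∣ X ∣)

IsSgcNumber : Graph → ℕ → Set
IsSgcNumber G c =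
  (∃[ S ] (IsSgSet G S × IsSgcOfSet G S c)) ×
  (∀ S c' → IsSgSet G S → IsSgcOfSet G S c' → c ℕ.≤ c')

GeneralizedGeodetic : Graph → Set
GeneralizedGeodetic G = ∃[ k ] (IsGeodeticNumber G k × IsSgNumber G k)

-- Cartesian product G □ H on Fin (n G * n H), vertex (g,h) encoded via combine/remQuot
_□_ : Graph → Graph → Graph
G □ H = record
  { n = n G ℕ.* n H
  ; adj = λ a b → f (remQuot (n H) a) (remQuot (n H) b)
  ; sym = λ a b → fsym (remQuot (n H) a) (remQuot (n H) b)
  ; irref = λ a → firr (remQuot (n H) a)
  }
  where
  f : Fin (n G) × Fin (n H) → Fin (n G) × Fin (n H) → Bool
  f (g , h) (g' , h') = (⌊ g ≟ g' ⌋ ∧ adj H h h') ∨ (⌊ h ≟ h' ⌋ ∧ adj G g g')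
  fsym : ∀ p q → f p q ≡ f q p
  fsym (g , h) (g' , h')
    rewrite ≟-sym g g' | ≟-sym h h' | Graph.sym G g g' | Graph.sym H h h' = refl
  firr : ∀ p → f p p ≡ false
  firr (g , h) rewrite ≟-refl g | ≟-refl h | irref G g | irref H h = refl

Convex : (H : Graph) → Subset (n H) → Set
Convex H K = ∀ (u v : Vertex H) → u ∈ K → v ∈ K → (P : Geodesic H u v) →
             ∀ x → OnGeo H x P → x ∈ K

ConvexTwoPartition : Graph → Set
ConvexTwoPartition H = ∃[ A ]
  ((∃[ a ] a ∈ A) × (∃[ b ] b ∉ A) ×
   Convex H A × Convex H (∁ A))

module Submission where

-- Let S be an sg-set of G □ H and T ⊆ V(G) its projection to G.  The
-- G-shadow of a geodesic of G □ H is a geodesic of G, so T is a geodetic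
-- set of G and sg(G) = g(G) ≤ |T| ≤ |S|.  Suppose sg(G) = |S|.  Then the
-- projection is injective on S, so the shadows of the chosen paths of S
-- form a path choice for T, which makes T an sg-set of G.  Split S by the
-- H-coordinate along a convex 2-partition (A, ∁A) of H.  A layer G × {a}
-- with a ∈ A cannot be reached by a chosen path with both ends in the
-- convex slab G × ∁A, so the projection of S ∩ (G × A) is a strong
-- geodetic core of T, and symmetrically for ∁A.  Hence
-- 2 sgc(G) ≤ |S| = sg(G), a contradiction.

open import Defs
open import Data.Nat as ℕ using (ℕ; suc; _+_; _*_; _≤_; _<_; _≤?_)
open import Data.Nat.Properties as ℕP using (≤-trans; ≤-reflexive; +-mono-≤; module ≤-Reasoning)
open import Data.Nat.Induction using (<-rec)
open import Data.Bool using (Bool; _∧_; _∨_) renaming (T to IsTrue)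
open import Data.Bool.Properties using (T-∨; T-∧)
open import Data.Fin as Fin using (Fin; zero; suc; remQuot; combine; _≟_)
open import Data.Fin.Properties as FP using (remQuot-combine; combine-remQuot)
open import Data.Fin.Subset using (Subset; _∈_; _∉_; _⊆_; ∁; _∩_; _∪_; ⁅_⁆; _-_; ∣_∣; inside; outside)
  renaming (⊥ to ∅)
open import Data.Fin.Subset.Properties
  using (∉⊥; ∣⊥∣≡0; ∣⁅x⁆∣≡1; x∈⁅x⁆; x∈⁅y⁆⇒x≡y; x∈p∪q⁺; x∈p∪q⁻; x∈p∩q⁺; x∈p∩q⁻; _∈?_;
         x∉p⇒x∈∁p; x∉∁p⇒x∈p; x∈p⇒x∉∁p; p⊆q⇒∣p∣≤∣q∣; x∈p⇒∣p-x∣<∣p∣; x∈p∧x≢y⇒x∈p-y)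
open import Data.Vec using ([]; _∷_; lookup; tabulate; here; there)
open import Data.Vec.Properties using (lookup∘tabulate; []=⇒lookup; lookup⇒[]=)
open import Data.Vec.Properties.WithK using ([]=-irrelevant)
open import Data.Product using (Σ; ∃-syntax; _×_; _,_; proj₁; proj₂)
open import Data.Sum using (_⊎_; inj₁; inj₂)
open import Data.Empty using (⊥; ⊥-elim)
open import Function using (_∘_)
open import Function.Bundles using (Equivalence)
open import Relation.Binary.PropositionalEquality
  using (_≡_; _≢_; refl; trans; cong; cong₂; subst) renaming (sym to ≡-sym)
open import Relation.Binary.Definitions using (tri<; tri≈; tri>)
open import Relation.Nullary using (¬_; Dec; yes; no)
open import Relation.Nullary.Decidable using (⌊_⌋; toWitness; fromWitness; decidable-stable; ¬¬-excluded-middle)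
open import Relation.Nullary.Negation using (¬¬-map)

open Equivalence using (to; from)

-- Walks and geodesics in an arbitrary graph

module Walks (G : Graph) where

  adj-sym : ∀ {x y} → Adj G x y → Adj G y x
  adj-sym {x} {y} = subst IsTrue (Graph.sym G x y)

  on-start : ∀ {x y k} (w : Walk G x y k) → OnWalk G x w
  on-start []      = here-nil
  on-start (e ∷ w) = here-cons e w

  _∷ʳ_ : ∀ {x y z k} → Walk G x y k → Adj G y z → Walk G x z (suc k)
  []       ∷ʳ e = e ∷ []
  (e′ ∷ w) ∷ʳ e = e′ ∷ (w ∷ʳ e)

  on-∷ʳ : ∀ {x y z k v} (w : Walk G x y k) (e : Adj G y z) → OnWalk G v w → OnWalk G v (w ∷ʳ e)
  on-∷ʳ []       e here-nil              = here-cons e []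
  on-∷ʳ (e′ ∷ w) e (here-cons .e′ .w) = here-cons e′ _
  on-∷ʳ (e′ ∷ w) e (there .e′ p)      = there e′ (on-∷ʳ w e p)

  on-∷ʳ-end : ∀ {x y z k} (w : Walk G x y k) (e : Adj G y z) → OnWalk G z (w ∷ʳ e)
  on-∷ʳ-end []       e = there e here-nil
  on-∷ʳ-end (e′ ∷ w) e = there e′ (on-∷ʳ-end w e)

  reverse : ∀ {x y k} → Walk G x y k → Walk G y x k
  reverse []      = []
  reverse (e ∷ w) = reverse w ∷ʳ adj-sym e

  on-reverse : ∀ {x y k v} (w : Walk G x y k) → OnWalk G v w → OnWalk G v (reverse w)
  on-reverse (e ∷ w) (here-cons .e .w) = on-∷ʳ-end (reverse w) (adj-sym e)
  on-reverse (e ∷ w) (there .e p)      = on-∷ʳ (reverse w) (adj-sym e) (on-reverse w p)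
  on-reverse []      here-nil          = here-nil

  reverse-geodesic : ∀ {x y} → Geodesic G x y → Geodesic G y x
  reverse-geodesic P = record
    { len = Geodesic.len P
    ; walk = reverse (Geodesic.walk P)
    ; shortest = λ w → Geodesic.shortest P (reverse w)
    }

  on-reverse-geodesic : ∀ {x y v} (P : Geodesic G x y) → OnGeo G v P → OnGeo G v (reverse-geodesic P)
  on-reverse-geodesic P = on-reverse (Geodesic.walk P)

  _++_ : ∀ {x y z i j} → Walk G x y i → Walk G y z j → Walk G x z (i + j)
  []      ++ w′ = w′
  (e ∷ w) ++ w′ = e ∷ (w ++ w′)

  cast : ∀ {x x′ y y′ k} → x ≡ x′ → y ≡ y′ → Walk G x y k → Walk G x′ y′ k
  cast refl refl w = w

  on-cast : ∀ {x x′ y y′ k v} (ex : x ≡ x′) (ey : y ≡ y′) (w : Walk G x y k) →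
            OnWalk G v w → OnWalk G v (cast ex ey w)
  on-cast refl refl w p = p

  cast-geodesic : ∀ {x x′ y y′} → x ≡ x′ → y ≡ y′ → Geodesic G x y → Geodesic G x′ y′
  cast-geodesic refl refl P = P

  on-cast-geodesic : ∀ {x x′ y y′ v} (ex : x ≡ x′) (ey : y ≡ y′) (P : Geodesic G x y) →
                     OnGeo G v P → OnGeo G v (cast-geodesic ex ey P)
  on-cast-geodesic refl refl P p = p

open Walks

-- Shadows of walks in the Cartesian product G □ H

module Product (G H : Graph) where

  GH : Graph
  GH = G □ H

  prG : Vertex GH → Vertex G
  prG z = proj₁ (remQuot {n G} (n H) z)

  prH : Vertex GH → Vertex H
  prH z = proj₂ (remQuot {n G} (n H) z)

  pair : Vertex G → Vertex H → Vertex GH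
  pair = combine

  prG-pair : ∀ g h → prG (pair g h) ≡ g
  prG-pair g h = cong proj₁ (remQuot-combine g h)

  prH-pair : ∀ g h → prH (pair g h) ≡ h
  prH-pair g h = cong proj₂ (remQuot-combine g h)

  pair-pr : ∀ z → pair (prG z) (prH z) ≡ z
  pair-pr = combine-remQuot {n G} (n H)

  adj-pairs : Vertex G × Vertex H → Vertex G × Vertex H → Bool
  adj-pairs (g , h) (g′ , h′) = (⌊ g ≟ g′ ⌋ ∧ adj H h h′) ∨ (⌊ h ≟ h′ ⌋ ∧ adj G g g′)

  split-pairs : ∀ g h g′ h′ → IsTrue (adj-pairs (g , h) (g′ , h′)) →
    (g ≡ g′ × Adj H h h′) ⊎ (h ≡ h′ × Adj G g g′)
  split-pairs g h g′ h′ e with to (T-∨ {x = ⌊ g ≟ g′ ⌋ ∧ adj H h h′}) e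
  ... | inj₁ t = let (same , edge) = to (T-∧ {x = ⌊ g ≟ g′ ⌋}) t in inj₁ (toWitness same , edge)
  ... | inj₂ t = let (same , edge) = to (T-∧ {x = ⌊ h ≟ h′ ⌋}) t in inj₂ (toWitness same , edge)

  edge-split : ∀ {z z′} → Adj GH z z′ →
    (prG z ≡ prG z′ × Adj H (prH z) (prH z′)) ⊎ (prH z ≡ prH z′ × Adj G (prG z) (prG z′))
  edge-split = split-pairs _ _ _ _

  lift-edgeG : ∀ {g g′} h → Adj G g g′ → Adj GH (pair g h) (pair g′ h)
  lift-edgeG {g} {g′} h e =
    subst IsTrue (cong₂ adj-pairs (≡-sym (remQuot-combine g h)) (≡-sym (remQuot-combine g′ h)))
      (from T-∨ (inj₂ (from T-∧ (fromWitness {a? = h ≟ h} refl , e))))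

  lift-edgeH : ∀ g {h h′} → Adj H h h′ → Adj GH (pair g h) (pair g h′)
  lift-edgeH g {h} {h′} e =
    subst IsTrue (cong₂ adj-pairs (≡-sym (remQuot-combine g h)) (≡-sym (remQuot-combine g h′)))
      (from T-∨ (inj₁ (from T-∧ (fromWitness {a? = g ≟ g} refl , e))))

  liftG : ∀ {g g′ i} h → Walk G g g′ i → Walk GH (pair g h) (pair g′ h) i
  liftG h []      = []
  liftG h (e ∷ w) = lift-edgeG h e ∷ liftG h w

  liftH : ∀ g {h h′ j} → Walk H h h′ j → Walk GH (pair g h) (pair g h′) j
  liftH g []      = []
  liftH g (e ∷ w) = lift-edgeH g e ∷ liftH g w

  recombine : ∀ {z z′ i j} → Walk G (prG z) (prG z′) i → Walk H (prH z) (prH z′) j → Walk GH z z′ (i + j)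
  recombine {z} {z′} wG wH = cast GH (pair-pr z) (pair-pr z′) (_++_ GH (liftG (prH z) wG) (liftH (prG z′) wH))

  record Shadows {z z′ : Vertex GH} {L : ℕ} (w : Walk GH z z′ L) : Set where
    field
      lenG lenH : ℕ
      lengths   : lenG + lenH ≡ L
      walkG     : Walk G (prG z) (prG z′) lenG
      walkH     : Walk H (prH z) (prH z′) lenH
      onG       : ∀ {v} → OnWalk GH v w → OnWalk G (prG v) walkG
      onH       : ∀ {v} → OnWalk GH v w → OnWalk H (prH v) walkH

  shadows : ∀ {z z′ L} (w : Walk GH z z′ L) → Shadows w
  shadows [] = record
    { lenG = 0 ; lenH = 0 ; lengths = refl ; walkG = [] ; walkH = []
    ; onG = λ { here-nil → here-nil } ; onH = λ { here-nil → here-nil } }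
  shadows {z} {z′} (_∷_ {y = y} e w) with edge-split e | shadows w
  ... | inj₁ (sameG , eH) | r = record
    { lenG = lenG ; lenH = suc lenH
    ; lengths = trans (ℕP.+-suc lenG lenH) (cong suc lengths)
    ; walkG = cast G (≡-sym sameG) refl walkG
    ; walkH = eH ∷ walkH
    ; onG = λ { (here-cons .e .w) → on-start G _
              ; (there .e p)      → on-cast G (≡-sym sameG) refl walkG (onG p) }
    ; onH = λ { (here-cons .e .w) → here-cons eH _
              ; (there .e p)      → there eH (onH p) } }
    where open Shadows r
  ... | inj₂ (sameH , eG) | r = record
    { lenG = suc lenG ; lenH = lenH
    ; lengths = cong suc lengths
    ; walkG = eG ∷ walkG
    ; walkH = cast H (≡-sym sameH) refl walkH
    ; onG = λ { (here-cons .e .w) → here-cons eG _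
              ; (there .e p)      → there eG (onG p) }
    ; onH = λ { (here-cons .e .w) → on-start H _
              ; (there .e p)      → on-cast H (≡-sym sameH) refl walkH (onH p) } }
    where open Shadows r

  -- The G-shadow of a geodesic is a geodesic: a shorter G-walk, recombined with
  -- the H-shadow, would give a shorter walk in G □ H.
  shadowG : ∀ {z z′} (P : Geodesic GH z z′) →
    Σ (Geodesic G (prG z) (prG z′)) λ Q → ∀ {v} → OnGeo GH v P → OnGeo G (prG v) Q
  shadowG P = record { len = lenG ; walk = walkG ; shortest = shortest } , onG
    where
    open Shadows (shadows (Geodesic.walk P))
    shortest : ∀ {k} → Walk G _ _ k → lenG ≤ k
    shortest {k} w = ℕP.+-cancelʳ-≤ lenH lenG k
      (subst (_≤ k + lenH) (≡-sym lengths) (Geodesic.shortest P (recombine w walkH)))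

  shadowH : ∀ {z z′} (P : Geodesic GH z z′) →
    Σ (Geodesic H (prH z) (prH z′)) λ Q → ∀ {v} → OnGeo GH v P → OnGeo H (prH v) Q
  shadowH P = record { len = lenH ; walk = walkH ; shortest = shortest } , onH
    where
    open Shadows (shadows (Geodesic.walk P))
    shortest : ∀ {k} → Walk H _ _ k → lenH ≤ k
    shortest {k} w = ℕP.+-cancelˡ-≤ lenG lenH k
      (subst (_≤ lenG + k) (≡-sym lengths) (Geodesic.shortest P (recombine walkG w)))

-- Images and preimages of finite subsets

image : ∀ {N M} → (Fin N → Fin M) → Subset N → Subset M
image f []            = ∅
image f (inside ∷ S)  = ⁅ f zero ⁆ ∪ image (f ∘ suc) S
image f (outside ∷ S) = image (f ∘ suc) S

∈-image : ∀ {N M} (f : Fin N → Fin M) {S : Subset N} {x} → x ∈ S → f x ∈ image f S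
∈-image f {inside ∷ S}  here      = x∈p∪q⁺ (inj₁ (x∈⁅x⁆ (f zero)))
∈-image f {inside ∷ S}  (there p) = x∈p∪q⁺ (inj₂ (∈-image (f ∘ suc) p))
∈-image f {outside ∷ S} (there p) = ∈-image (f ∘ suc) p

image-preimage : ∀ {N M} (f : Fin N → Fin M) (S : Subset N) {y} → y ∈ image f S → ∃[ x ] (x ∈ S × f x ≡ y)
image-preimage f [] p = ⊥-elim (∉⊥ p)
image-preimage f (inside ∷ S) p with x∈p∪q⁻ ⁅ f zero ⁆ (image (f ∘ suc) S) p
... | inj₁ q = zero , here , ≡-sym (x∈⁅y⁆⇒x≡y _ q)
... | inj₂ q = let (x , x∈ , fx≡y) = image-preimage (f ∘ suc) S q in suc x , there x∈ , fx≡y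
image-preimage f (outside ∷ S) p = let (x , x∈ , fx≡y) = image-preimage (f ∘ suc) S p in suc x , there x∈ , fx≡y

∣p∪q∣≤∣p∣+∣q∣ : ∀ {m} (p q : Subset m) → ∣ p ∪ q ∣ ≤ ∣ p ∣ + ∣ q ∣
∣p∪q∣≤∣p∣+∣q∣ []            []            = ℕ.z≤n
∣p∪q∣≤∣p∣+∣q∣ (inside ∷ p)  (inside ∷ q)  = ℕ.s≤s (≤-trans (∣p∪q∣≤∣p∣+∣q∣ p q) (ℕP.+-monoʳ-≤ ∣ p ∣ (ℕP.n≤1+n _)))
∣p∪q∣≤∣p∣+∣q∣ (inside ∷ p)  (outside ∷ q) = ℕ.s≤s (∣p∪q∣≤∣p∣+∣q∣ p q)
∣p∪q∣≤∣p∣+∣q∣ (outside ∷ p) (inside ∷ q)  = ≤-trans (ℕ.s≤s (∣p∪q∣≤∣p∣+∣q∣ p q)) (≤-reflexive (≡-sym (ℕP.+-suc ∣ p ∣ ∣ q ∣)))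
∣p∪q∣≤∣p∣+∣q∣ (outside ∷ p) (outside ∷ q) = ∣p∪q∣≤∣p∣+∣q∣ p q

∣image∣≤∣p∣ : ∀ {N M} (f : Fin N → Fin M) (S : Subset N) → ∣ image f S ∣ ≤ ∣ S ∣
∣image∣≤∣p∣ {M = M} f [] = ≤-reflexive (∣⊥∣≡0 M)
∣image∣≤∣p∣ f (inside ∷ S) =
  ≤-trans (∣p∪q∣≤∣p∣+∣q∣ ⁅ f zero ⁆ (image (f ∘ suc) S))
          (subst (λ t → t + ∣ image (f ∘ suc) S ∣ ≤ suc ∣ S ∣) (≡-sym (∣⁅x⁆∣≡1 (f zero)))
                 (ℕ.s≤s (∣image∣≤∣p∣ (f ∘ suc) S)))
∣image∣≤∣p∣ f (outside ∷ S) = ∣image∣≤∣p∣ (f ∘ suc) S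

image-shrinks : ∀ {N M} (f : Fin N → Fin M) (S : Subset N) {x x′} →
  x ∈ S → x′ ∈ S → x ≢ x′ → f x ≡ f x′ → ∣ image f S ∣ < ∣ S ∣
image-shrinks f S {x} {x′} x∈ x′∈ x≢x′ fx≡fx′ =
  ℕP.≤-<-trans (p⊆q⇒∣p∣≤∣q∣ image⊆) (ℕP.≤-<-trans (∣image∣≤∣p∣ f (S - x)) (x∈p⇒∣p-x∣<∣p∣ x∈))
  where
  image⊆ : image f S ⊆ image f (S - x)
  image⊆ p with image-preimage f S p
  ... | z , z∈ , fz≡y with z ≟ x
  ...   | yes refl = subst (_∈ image f (S - x)) (trans (≡-sym fx≡fx′) fz≡y)
                       (∈-image f (x∈p∧x≢y⇒x∈p-y x′∈ (x≢x′ ∘ ≡-sym)))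
  ...   | no z≢x   = subst (_∈ image f (S - x)) fz≡y (∈-image f (x∈p∧x≢y⇒x∈p-y z∈ z≢x))

image-injective : ∀ {N M} (f : Fin N → Fin M) (S : Subset N) → ∣ S ∣ ≤ ∣ image f S ∣ →
  ∀ {x x′} → x ∈ S → x′ ∈ S → f x ≡ f x′ → x ≡ x′
image-injective f S full {x} {x′} x∈ x′∈ fx≡fx′ with x ≟ x′
... | yes x≡x′ = x≡x′
... | no x≢x′  = ⊥-elim (ℕP.<⇒≱ (image-shrinks f S x∈ x′∈ x≢x′ fx≡fx′) full)

preimage : ∀ {N M} → (Fin N → Fin M) → Subset M → Subset N
preimage f A = tabulate (λ z → lookup A (f z))

∈-preimage⁺ : ∀ {N M} (f : Fin N → Fin M) (A : Subset M) {z} → f z ∈ A → z ∈ preimage f A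
∈-preimage⁺ f A {z} p = lookup⇒[]= z _ (trans (lookup∘tabulate _ z) ([]=⇒lookup p))

∈-preimage⁻ : ∀ {N M} (f : Fin N → Fin M) (A : Subset M) {z} → z ∈ preimage f A → f z ∈ A
∈-preimage⁻ f A {z} p = lookup⇒[]= (f z) A (trans (≡-sym (lookup∘tabulate _ z)) ([]=⇒lookup p))

∣p∩q∣+∣p∩∁q∣≡∣p∣ : ∀ {m} (S Q : Subset m) → ∣ S ∩ Q ∣ + ∣ S ∩ ∁ Q ∣ ≡ ∣ S ∣
∣p∩q∣+∣p∩∁q∣≡∣p∣ []            []            = refl
∣p∩q∣+∣p∩∁q∣≡∣p∣ (inside ∷ S)  (inside ∷ Q)  = cong suc (∣p∩q∣+∣p∩∁q∣≡∣p∣ S Q)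
∣p∩q∣+∣p∩∁q∣≡∣p∣ (inside ∷ S)  (outside ∷ Q) = trans (ℕP.+-suc ∣ S ∩ Q ∣ _) (cong suc (∣p∩q∣+∣p∩∁q∣≡∣p∣ S Q))
∣p∩q∣+∣p∩∁q∣≡∣p∣ (outside ∷ S) (inside ∷ Q)  = ∣p∩q∣+∣p∩∁q∣≡∣p∣ S Q
∣p∩q∣+∣p∩∁q∣≡∣p∣ (outside ∷ S) (outside ∷ Q) = ∣p∩q∣+∣p∩∁q∣≡∣p∣ S Q

-- Facts on sg(G) and sgc(G)

-- Classically every inhabited predicate has an element of least size;
-- constructively this holds under double negation (strong induction on the size).
¬¬-least : {A : Set} (P : A → Set) (size : A → ℕ) {x : A} → P x →
  ¬ ¬ (Σ A λ y → P y × (∀ z → P z → size y ≤ size z))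
¬¬-least {A} P size {x} px = <-rec Goal step (size x) x refl px
  where
  Goal : ℕ → Set
  Goal s = ∀ x → size x ≡ s → P x → ¬ ¬ (Σ A λ y → P y × (∀ z → P z → size y ≤ size z))
  step : ∀ s → (∀ {t} → t < s → Goal t) → Goal s
  step s smaller x refl px no-least = ¬¬-excluded-middle smaller-or-least
    where
    smaller-or-least : Dec (Σ A λ z → P z × size z < size x) → ⊥
    smaller-or-least (yes (z , pz , z<x)) = smaller z<x z refl pz no-least
    smaller-or-least (no none) = no-least (x , px , λ z pz → ℕP.≮⇒≥ (λ z<x → none (z , pz , z<x)))

sg-unique : ∀ {G k k′} → IsSgNumber G k → IsSgNumber G k′ → k ≡ k′
sg-unique {k = k} {k′} ((S , S-strong , ∣S∣≡k) , k-min) ((S′ , S′-strong , ∣S′∣≡k′) , k′-min) =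
  ℕP.≤-antisym (subst (k ≤_) ∣S′∣≡k′ (k-min S′ S′-strong)) (subst (k′ ≤_) ∣S∣≡k (k′-min S S-strong))

-- Every strong geodetic core of an sg-set has at least sgc(G) elements:
-- compare with a core of least size, which realizes sgc of that set.
sgc-lower-bound : ∀ {G c T X} → IsSgcNumber G c → IsSgSet G T → IsCore G T X → c ≤ ∣ X ∣
sgc-lower-bound {G} {c} {T} {X} (_ , c-min) T-sg X-core =
  decidable-stable (c ≤? ∣ X ∣) (¬¬-map via-least (¬¬-least (IsCore G T) ∣_∣ X-core))
  where
  via-least : (Σ _ λ Y → IsCore G T Y × (∀ Z → IsCore G T Z → ∣ Y ∣ ≤ ∣ Z ∣)) → c ≤ ∣ X ∣
  via-least (Y , Y-core , Y-least) =
    ≤-trans (c-min T ∣ Y ∣ T-sg ((Y , Y-core , refl) , Y-least)) (Y-least X X-core)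

-- The projection to G of a strong geodetic set S of G □ H

module Projection (G H : Graph) (S : Subset (n (G □ H))) (SP : PathChoice (G □ H) S)
  (covers : ∀ v → ∃[ u ] ∃[ w ] Σ (u ∈ S) λ u∈ → Σ (w ∈ S) λ w∈ → OnChosen (G □ H) S SP u w v u∈ w∈)
  where

  open Product G H

  T : Subset (n G)
  T = image prG S

  chosen-swap : ∀ {u w z u∈ w∈} → OnChosen GH S SP u w z u∈ w∈ → OnChosen GH S SP w u z w∈ u∈
  chosen-swap (inj₁ on) = inj₂ on
  chosen-swap (inj₂ on) = inj₁ on

  chosen-distinct : ∀ {u w z u∈ w∈} → OnChosen GH S SP u w z u∈ w∈ → u ≢ w
  chosen-distinct (inj₁ (u<w , _)) refl = FP.<-irrefl refl u<w
  chosen-distinct (inj₂ (w<u , _)) refl = FP.<-irrefl refl w<u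

  chosen-in-intervalG : ∀ {u w z u∈ w∈} → OnChosen GH S SP u w z u∈ w∈ → InInterval G (prG u) (prG w) (prG z)
  chosen-in-intervalG (inj₁ (lt , on)) = let (P , onP) = shadowG (SP _ _ _ _ lt) in P , onP on
  chosen-in-intervalG (inj₂ (lt , on)) =
    let (P , onP) = shadowG (SP _ _ _ _ lt) in reverse-geodesic G P , on-reverse-geodesic G P (onP on)

  chosen-in-intervalH : ∀ {u w z u∈ w∈} → OnChosen GH S SP u w z u∈ w∈ → InInterval H (prH u) (prH w) (prH z)
  chosen-in-intervalH (inj₁ (lt , on)) = let (P , onP) = shadowH (SP _ _ _ _ lt) in P , onP on
  chosen-in-intervalH (inj₂ (lt , on)) =
    let (P , onP) = shadowH (SP _ _ _ _ lt) in reverse-geodesic H P , on-reverse-geodesic H P (onP on)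

  -- T is a geodetic set of G: cover the layer G × {h} by chosen paths of S.
  T-geodetic : Vertex H → IsGeodeticSet G T
  T-geodetic h g with covers (pair g h)
  ... | u , w , u∈ , w∈ , on =
    prG u , prG w , ∈-image prG u∈ , ∈-image prG w∈ ,
    subst (InInterval G (prG u) (prG w)) (prG-pair g h) (chosen-in-intervalG on)

  chosen-in-slab : ∀ {C u w z u∈ w∈} → Convex H C → prH u ∈ C → prH w ∈ C →
    OnChosen GH S SP u w z u∈ w∈ → prH z ∈ C
  chosen-in-slab convex u∈C w∈C on =
    let (P , onP) = chosen-in-intervalH on in convex _ _ u∈C w∈C P _ onP

  route : ∀ {u w} → u ∈ S → w ∈ S → u ≢ w → Geodesic GH u w
  route {u} {w} u∈ w∈ u≢w with FP.<-cmp u w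
  ... | tri< u<w _ _ = SP u w u∈ w∈ u<w
  ... | tri≈ _ u≡w _ = ⊥-elim (u≢w u≡w)
  ... | tri> _ _ w<u = reverse-geodesic GH (SP w u w∈ u∈ w<u)

  on-route : ∀ {u w z u∈ w∈} (u∈′ : u ∈ S) (w∈′ : w ∈ S) (u≢w : u ≢ w) →
    OnChosen GH S SP u w z u∈ w∈ → OnGeo GH z (route u∈′ w∈′ u≢w)
  on-route {u} {w} {u∈ = u∈} {w∈} u∈′ w∈′ u≢w on
    with []=-irrelevant u∈ u∈′ | []=-irrelevant w∈ w∈′ | FP.<-cmp u w | on
  ... | refl | refl | tri< u<w _ _ | inj₁ (u<w′ , on′) with FP.<-irrelevant u<w u<w′
  ...   | refl = on′
  on-route _ _ _ _ | refl | refl | tri< u<w _ _ | inj₂ (w<u , _) = ⊥-elim (FP.<-asym u<w w<u)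
  on-route _ _ u≢w _ | refl | refl | tri≈ _ u≡w _ | _ = ⊥-elim (u≢w u≡w)
  on-route _ _ _ _ | refl | refl | tri> _ _ w<u | inj₁ (u<w , _) = ⊥-elim (FP.<-asym u<w w<u)
  on-route {u} {w} u∈′ w∈′ _ _ | refl | refl | tri> _ _ w<u | inj₂ (w<u′ , on′) with FP.<-irrelevant w<u w<u′
  ...   | refl = on-reverse-geodesic GH (SP w u w∈′ u∈′ w<u) on′

  module Injective (inj : ∀ {u w} → u ∈ S → w ∈ S → prG u ≡ prG w → u ≡ w) where

    Preimage : Vertex G → Set
    Preimage x = ∃[ u ] (u ∈ S × prG u ≡ x)

    preimages-distinct : ∀ {u w x y} → prG u ≡ x → prG w ≡ y → x Fin.< y → u ≢ w
    preimages-distinct eu ew x<y u≡w = FP.<-irrefl (trans (≡-sym eu) (trans (cong prG u≡w) ew)) x<y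

    routeG : ∀ {x y} → Preimage x → Preimage y → x Fin.< y → Geodesic G x y
    routeG (u , u∈ , eu) (w , w∈ , ew) x<y =
      cast-geodesic G eu ew (proj₁ (shadowG (route u∈ w∈ (preimages-distinct eu ew x<y))))

    preimage-of : ∀ {x} → x ∈ T → Preimage x
    preimage-of = image-preimage prG S

    Q : PathChoice G T
    Q x y x∈ y∈ = routeG (preimage-of x∈) (preimage-of y∈)

    -- By injectivity the preimages are the ends u, w themselves, so the shadow
    -- of the chosen path through z passes through prG z.
    on-routeG : ∀ {u w z u∈ w∈} (pu : Preimage (prG u)) (pw : Preimage (prG w)) (lt : prG u Fin.< prG w) →
      OnChosen GH S SP u w z u∈ w∈ → OnGeo G (prG z) (routeG pu pw lt)
    on-routeG {u} {w} {u∈ = u∈} {w∈} (u′ , u′∈ , eu) (w′ , w′∈ , ew) lt on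
      with inj u′∈ u∈ eu | inj w′∈ w∈ ew
    ... | refl | refl = on-cast-geodesic G eu ew _ (proj₂ (shadowG (route u′∈ w′∈ u≢w)) (on-route u′∈ w′∈ u≢w on))
      where
      u≢w : u ≢ w
      u≢w = preimages-distinct eu ew lt

    project-chosen : ∀ {u w z u∈ w∈} → OnChosen GH S SP u w z u∈ w∈ →
      (x∈ : prG u ∈ T) (y∈ : prG w ∈ T) → OnChosen G T Q (prG u) (prG w) (prG z) x∈ y∈
    project-chosen {u} {w} {u∈ = u∈} {w∈} on x∈ y∈ with FP.<-cmp (prG u) (prG w)
    ... | tri< x<y _ _ = inj₁ (x<y , on-routeG (preimage-of x∈) (preimage-of y∈) x<y on)
    ... | tri≈ _ x≡y _ = ⊥-elim (chosen-distinct on (inj u∈ w∈ x≡y))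
    ... | tri> _ _ y<x = inj₂ (y<x , on-routeG (preimage-of y∈) (preimage-of x∈) y<x (chosen-swap on))

    project-layer : ∀ {u w g h u∈ w∈} → OnChosen GH S SP u w (pair g h) u∈ w∈ →
      (x∈ : prG u ∈ T) (y∈ : prG w ∈ T) → OnChosen G T Q (prG u) (prG w) g x∈ y∈
    project-layer {g = g} {h} on x∈ y∈ =
      subst (λ t → OnChosen G T Q _ _ t x∈ y∈) (prG-pair g h) (project-chosen on x∈ y∈)

    T-strong : Vertex H → IsStrongGeodeticSet G T
    T-strong h = Q , cover
      where
      cover : ∀ g → ∃[ x ] ∃[ y ] Σ (x ∈ T) λ x∈ → Σ (y ∈ T) λ y∈ → OnChosen G T Q x y g x∈ y∈
      cover g with covers (pair g h)
      ... | u , w , u∈ , w∈ , on =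
        prG u , prG w , ∈-image prG u∈ , ∈-image prG w∈ , project-layer on _ _

    -- If every vertex of S outside R lies in a convex slab G × C missing some
    -- layer G × {h}, then the projection of S ∩ R is a core of T: a path of
    -- G □ H reaching that layer has an end in R.
    slab-core : ∀ C → Convex H C → (h : Vertex H) → h ∉ C →
      (R : Subset (n GH)) → (∀ {z} → z ∈ S → z ∉ R → prH z ∈ C) → IsCore G T (image prG (S ∩ R))
    slab-core C convex h h∉C R outside∈C = X⊆T , Q , cover
      where
      X⊆T : image prG (S ∩ R) ⊆ T
      X⊆T x∈ with image-preimage prG (S ∩ R) x∈
      ... | z , z∈ , refl = ∈-image prG (proj₁ (x∈p∩q⁻ S R z∈))

      cover : ∀ g → ∃[ x ] ∃[ y ] Σ (x ∈ image prG (S ∩ R)) λ x∈ → Σ (y ∈ T) λ y∈ →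
                      OnChosen G T Q x y g (X⊆T x∈) y∈
      cover g with covers (pair g h)
      ... | u , w , u∈ , w∈ , on with u ∈? R | w ∈? R
      ...   | yes u∈R | _       = prG u , prG w , ∈-image prG (x∈p∩q⁺ (u∈ , u∈R)) , ∈-image prG w∈ ,
                                  project-layer on _ _
      ...   | no _    | yes w∈R = prG w , prG u , ∈-image prG (x∈p∩q⁺ (w∈ , w∈R)) , ∈-image prG u∈ ,
                                  project-layer (chosen-swap on) _ _
      ...   | no u∉R  | no w∉R  = ⊥-elim (h∉C (subst (_∈ C) (prH-pair g h)
                                    (chosen-in-slab convex (outside∈C u∈ u∉R) (outside∈C w∈ w∉R) on)))

    two-cores : ConvexTwoPartition H →
      Σ (Subset (n G)) λ X → Σ (Subset (n G)) λ Y → IsCore G T X × IsCore G T Y × ∣ X ∣ + ∣ Y ∣ ≤ ∣ S ∣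
    two-cores (A , (a , a∈A) , (b , b∉A) , convex-A , convex-∁A) =
      image prG (S ∩ R) , image prG (S ∩ ∁ R) ,
      slab-core (∁ A) convex-∁A a (x∈p⇒x∉∁p a∈A) R (λ _ z∉R → x∉p⇒x∈∁p (z∉R ∘ ∈-preimage⁺ prH A)) ,
      slab-core A convex-A b b∉A (∁ R) (λ _ z∉∁R → ∈-preimage⁻ prH A (x∉∁p⇒x∈p z∉∁R)) ,
      ≤-trans (+-mono-≤ (∣image∣≤∣p∣ prG (S ∩ R)) (∣image∣≤∣p∣ prG (S ∩ ∁ R)))
              (≤-reflexive (∣p∩q∣+∣p∩∁q∣≡∣p∣ S R))
      where
      R : Subset (n GH)
      R = preimage prH A

theorem6p5 : (G H : Graph) → Connected G → Connected H →
    GeneralizedGeodetic G →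
    (k c : ℕ) → IsSgNumber G k → IsSgcNumber G c → k < 2 * c →
    ConvexTwoPartition H →
    ∀ m → IsSgNumber (G □ H) m → k < m
theorem6p5 G H _ _ (_ , (_ , g-min) , sg-g) k c sg-k sgc-c k<2c partition@(_ , (h , _) , _)
  m ((S , (SP , covers) , ∣S∣≡m) , _) = ℕP.≤∧≢⇒< k≤m k≢m
  where
  open Projection G H S SP covers
  open Product G H using (prG)

  k≤∣T∣ : k ≤ ∣ T ∣
  k≤∣T∣ = subst (_≤ ∣ T ∣) (sg-unique sg-g sg-k) (g-min T (T-geodetic h))

  k≤m : k ≤ m
  k≤m = ≤-trans k≤∣T∣ (subst (∣ T ∣ ≤_) ∣S∣≡m (∣image∣≤∣p∣ prG S))

  k≢m : k ≢ m
  k≢m k≡m = ℕP.<⇒≱ k<2c 2c≤k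
    where
    ∣S∣≤k : ∣ S ∣ ≤ k
    ∣S∣≤k = ≤-reflexive (trans ∣S∣≡m (≡-sym k≡m))

    open Injective (image-injective prG S (≤-trans ∣S∣≤k k≤∣T∣))

    T-sg : IsSgSet G T
    T-sg = T-strong h , λ S′ S′-strong → ≤-trans (∣image∣≤∣p∣ prG S) (≤-trans ∣S∣≤k (proj₂ sg-k S′ S′-strong))

    2c≤k : 2 * c ≤ k
    2c≤k with two-cores partition
    ... | X , Y , X-core , Y-core , ∣X∣+∣Y∣≤∣S∣ = begin
      2 * c         ≡⟨ cong (c +_) (ℕP.+-identityʳ c) ⟩
      c + c         ≤⟨ +-mono-≤ (sgc-lower-bound sgc-c T-sg X-core) (sgc-lower-bound sgc-c T-sg Y-core) ⟩
      ∣ X ∣ + ∣ Y ∣ ≤⟨ ∣X∣+∣Y∣≤∣S∣ ⟩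
      ∣ S ∣         ≤⟨ ∣S∣≤k ⟩
      k             ∎
      where open ≤-Reasoning
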